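{- Let $P$ be a threaded program with threads $T_1,\dots,T_N$, let $\eta$ and $\eta'$ be ARF nodes for $P$ such that $\eta'$ is a successor node of $\eta$, and let $\gamma$ be a configuration of $P$ with $\gamma\models\eta$. Then: (1) If $\eta'$ is obtained from $\eta$ by rule (E1) using the CFG edge labelled by the operation $op$, then every configuration $\gamma'$ of $P$ with $\gamma\xrightarrow{op}\gamma'$ satisfies $\gamma'\models\eta'$. (2) If $\eta'$ is obtained from $\eta$ by rule (E2), then every configuration $\gamma'$ of $P$ with $\gamma\xrightarrow{\cdot}\gamma'$ whose scheduler state coincides with the scheduler state of $\eta'$ satisfies $\gamma'\models\eta'$.
   Context: Operations. Program variables are integer valued. An operation is either an assignment $x:=e$, where $e$ is a variable, an integer constant, the nondeterministic construct $*$, an arithmetic combination of such expressions, or (only as the entire right-hand side) a call $f(e_1,\dots,e_n)$ to a primitive function; or an assumption $[b]$ with $b$ a Boolean expression (relational/Boolean operators). A control-flow graph (CFG) is $(L,E,l_0,L_{err})$: $L$ a set of locations, $E\subseteq L\times Ops\times L$ edges labelled by operations, $l_0$ an entry location with no incoming edges, $L_{err}\subseteq L$ error locations with no outgoing edges. Threaded programs. A threaded program $P$ consists of threads $T_1,\dots,T_N$, one of them designated $main$. Each $T_i$ has a CFG $G_{T_i}=(L_i,E_i,l_0^i,L^i_{err})$ and a set $LVar(T_i)$ of local variables; these sets are pairwise disjoint and disjoint from the set $GVar$ of global variables, and operations of $T_i$ mention only variables in $LVar(T_i)\cup GVar$. A state over a variable set $V$ is a map $V\to\mathbb Z$; for states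 $s_1,s_2$ with disjoint domains, $s_1\cup s_2$ is the state on the union of the domains agreeing with each. There is a set $SVar$ of scheduler variables; a scheduler state $\mathbb S$ is a valuation of $SVar$, which contains for each thread $T$ a variable $st_T$ with values in $\{Running,Runnable,Waiting\}$, and in every scheduler state at most one thread is Running. Each $n$-ary primitive function $f$ is associated with a function $f'$ that maps $n$ integers and a scheduler state to a pair (integer, scheduler state). A scheduler is a function $Sched$ mapping each scheduler state with no running thread to a set of scheduler states each having exactly one running thread. It is assumed that the arguments of every primitive function call are integer constants (known statically). Semantics. For a local state $s$, global state $gs$ and scheduler state $\mathbb S$, the value of an expression is: a variable's value in $s$ or $gs$; a constant itself; for $*$ any integer; arithmetic operations applied to the values of the subexpressions; in all these cases $\mathbb S$ is unchanged; for $f(e_1,\dots,e_n)$ the pair $f'(v_1,\dots,v_n,\mathbb S)$ where $v_k$ is the value of $e_k$. Boolean expressions are evaluated in the obvious way. A configuration is $\gamma=\langle (l_1,s_1),\dots,(l_N,s_N),gs,\mathbb S\rangle$ with $l_i\in L_i$, $s_i$ a state over $LVar(T_i)$, $gs$ a state over $GVar$, $\mathbb S$ a scheduler state. Transitions: if $\mathbb S(st_{T_i})=Running$ and $(l_i,op,l_i')\in E_i$, then (a) for $op=[b]$ with $b$ true in $(s_i,gs)$, $\gamma\xrightarrow{op}\gamma'$ where $\gamma'$ replaces $l_i$ by $l_i'$; (b) for $op= x:=e$ and any evaluation $(v,\mathbb S')$ of $e$, $\gamma\xrightarrow{op}\gamma'$ where $\gamma'$ replaces $l_i$ by $l_i'$,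 sets $x$ to $v$ (in $s_i$ if $x\in LVar(T_i)$, in $gs$ if $x\in GVar$) and replaces $\mathbb S$ by $\mathbb S'$. If no thread is Running in $\mathbb S$, then $\gamma\xrightarrow{\cdot}\gamma'$ for every $\gamma'$ obtained from $\gamma$ by replacing $\mathbb S$ by some $\mathbb S'\in Sched(\mathbb S)$. Symbolic notions. Formulas are quantifier-free-theory first-order formulas over program variables; $s\models\varphi$ means $\varphi$ holds in $s$. The strongest post-condition is $SP_{x:=e}(\varphi)=\exists x'.\,\varphi[x'/x]\wedge x=e[x'/x]$ for $e\neq *$, $SP_{x:=*}(\varphi)=\exists x'.\,\varphi[x'/x]\wedge x=a$ with $a$ a fresh variable, and $SP_{[b]}(\varphi)=\varphi\wedge b$. A precision $\pi$ is a finite set of predicates; the abstract strongest post-condition $SP^{\pi}_{op}(\varphi)$ is the strongest Boolean combination of predicates of $\pi$ implied (in the theory) by $SP_{op}(\varphi)$; in particular $SP_{op}(\varphi)\Rightarrow SP^\pi_{op}(\varphi)$ is valid. ARF nodes and expansion. An ARF node is $\eta=(\langle l_1,\varphi_1\rangle,\dots,\langle l_N,\varphi_N\rangle,\varphi,\mathbb S)$ with $l_i\in L_i$, $\varphi_i$ a formula over $LVar(T_i)\cup GVar$ (thread region), $\varphi$ a formula over all variables (global region), and $\mathbb S$ a scheduler state. Precisions $\pi_l$ are associated with locations $l$ and a precision $\pi$ with the global region. Rule (E1): if $T_i$ is Running in $\mathbb S$ and $(l_i,op,l_i')\in E_i$, let $\hat{op}=op$ and $\mathbb S'=\mathbb S$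 if $op$ contains no primitive call; if $op$ is $x:=f(\vec y)$, let $(v,\mathbb S')=f'(\vec y,\mathbb S)$ and $\hat{op}$ be $x:=v$. The successor node has location $l_i'$ for $T_i$ (other locations unchanged), thread region $\varphi_i'=SP^{\pi_{l_i'}}_{\hat{op}}(\varphi_i\wedge\varphi)$; for $j\neq i$, $\varphi_j'=SP^{\pi_{l_j}}_{havoc(\hat{op})}(\varphi_j\wedge\varphi)$ if $\hat{op}$ possibly updates global variables and $\varphi_j'=\varphi_j$ otherwise; global region $\varphi'=SP^{\pi}_{\hat{op}}(\varphi)$; scheduler state $\mathbb S'$. Here $havoc(\hat{op})$ is the operation assigning fresh variables to all global variables possibly updated by $\hat{op}$. Rule (E2): if no thread is Running in $\mathbb S$, then for each $\mathbb S'\in Sched(\mathbb S)$ the node $(\langle l_1,\varphi_1\rangle,\dots,\langle l_N,\varphi_N\rangle,\varphi,\mathbb S')$ is a successor. Satisfaction. A configuration $\langle (l_1,s_1),\dots,(l_N,s_N),gs,\mathbb S\rangle$ satisfies the node $(\langle l'_1,\varphi_1\rangle,\dots,\langle l'_N,\varphi_N\rangle,\varphi,\mathbb S')$, written $\gamma\models\eta$, iff $l_i=l_i'$ and $s_i\cup gs\models\varphi_i$ for all $i$, $s_1\cup\dots\cup s_N\cup gs\models\varphi$, and $\mathbb S=\mathbb S'$. -}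

module Defs where

open import Data.Nat using (ℕ)
open import Data.Integer using (ℤ; _+_; _-_; _*_; -_; _≤_; _<_)
open import Data.Fin using (Fin; _≟_)
open import Data.Vec using (Vec)
open import Data.List using (List; length; lookup)
open import Data.Product using (Σ; ∃; _×_; _,_; proj₁; proj₂)
open import Data.Sum using (_⊎_; inj₁; inj₂)
open import Data.Unit using (⊤; tt)
open import Data.Empty using (⊥)
open import Relation.Nullary using (¬_; yes; no)
open import Relation.Binary.PropositionalEquality
  using (_≡_; _≢_; refl; sym; trans; cong; cong₂; subst; _≗_)

-- Thread statuses (values of the scheduler variables st_T)

data Status : Set where
  Running Runnable Waiting : Status

-- star-free arithmetic terms (used inside Boolean expressions)
data Term (V : Set) : Set where
  tvar   : V → Term V
  tconst : ℤ → Term V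
  _t+_ _t-_ _t*_ : Term V → Term V → Term V
  t-_    : Term V → Term V

-- right-hand-side expressions: may contain the nondeterministic *
data Expr (V : Set) : Set where
  evar   : V → Expr V
  econst : ℤ → Expr V
  estar  : Expr V
  _e+_ _e-_ _e*_ : Expr V → Expr V → Expr V
  e-_    : Expr V → Expr V

data BExpr (V : Set) : Set where
  btrue bfalse : BExpr V
  _b≤_ _b<_ _b=_ : Term V → Term V → BExpr V
  _b∧_ _b∨_ : BExpr V → BExpr V → BExpr V
  b¬_ : BExpr V → BExpr V

⟦_⟧ₜ : {V : Set} → Term V → (V → ℤ) → ℤ
⟦ tvar x ⟧ₜ s = s x
⟦ tconst c ⟧ₜ s = c
⟦ a t+ b ⟧ₜ s = ⟦ a ⟧ₜ s + ⟦ b ⟧ₜ s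
⟦ a t- b ⟧ₜ s = ⟦ a ⟧ₜ s - ⟦ b ⟧ₜ s
⟦ a t* b ⟧ₜ s = ⟦ a ⟧ₜ s * ⟦ b ⟧ₜ s
⟦ t- a ⟧ₜ s = - ⟦ a ⟧ₜ s

data EvalE {V : Set} (s : V → ℤ) : Expr V → ℤ → Set where
  ev-var   : ∀ x → EvalE s (evar x) (s x)
  ev-const : ∀ c → EvalE s (econst c) c
  ev-star  : ∀ v → EvalE s estar v
  ev-+ : ∀ {a b u w} → EvalE s a u → EvalE s b w → EvalE s (a e+ b) (u + w)
  ev-- : ∀ {a b u w} → EvalE s a u → EvalE s b w → EvalE s (a e- b) (u - w)
  ev-* : ∀ {a b u w} → EvalE s a u → EvalE s b w → EvalE s (a e* b) (u * w)
  ev-neg : ∀ {a u} → EvalE s a u → EvalE s (e- a) (- u)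

EvalB : {V : Set} → BExpr V → (V → ℤ) → Set
EvalB btrue s = ⊤
EvalB bfalse s = ⊥
EvalB (a b≤ b) s = ⟦ a ⟧ₜ s ≤ ⟦ b ⟧ₜ s
EvalB (a b< b) s = ⟦ a ⟧ₜ s < ⟦ b ⟧ₜ s
EvalB (a b= b) s = ⟦ a ⟧ₜ s ≡ ⟦ b ⟧ₜ s
EvalB (p b∧ q) s = EvalB p s × EvalB q s
EvalB (p b∨ q) s = EvalB p s ⊎ EvalB q s
EvalB (b¬ p) s = ¬ EvalB p s

⟦⟧ₜ-resp : {V : Set} (t : Term V) {s s' : V → ℤ} → s ≗ s' → ⟦ t ⟧ₜ s ≡ ⟦ t ⟧ₜ s'
⟦⟧ₜ-resp (tvar x) eq = eq x
⟦⟧ₜ-resp (tconst c) eq = refl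
⟦⟧ₜ-resp (a t+ b) eq = cong₂ _+_ (⟦⟧ₜ-resp a eq) (⟦⟧ₜ-resp b eq)
⟦⟧ₜ-resp (a t- b) eq = cong₂ _-_ (⟦⟧ₜ-resp a eq) (⟦⟧ₜ-resp b eq)
⟦⟧ₜ-resp (a t* b) eq = cong₂ _*_ (⟦⟧ₜ-resp a eq) (⟦⟧ₜ-resp b eq)
⟦⟧ₜ-resp (t- a) eq = cong -_ (⟦⟧ₜ-resp a eq)

EvalB-resp : {V : Set} (b : BExpr V) {s s' : V → ℤ} → s ≗ s' → EvalB b s → EvalB b s'
EvalB-resp btrue eq h = h
EvalB-resp bfalse eq h = h
EvalB-resp (a b≤ b) eq h = subst₂' (⟦⟧ₜ-resp a eq) (⟦⟧ₜ-resp b eq) h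
  where subst₂' : ∀ {x x' y y'} → x ≡ x' → y ≡ y' → x ≤ y → x' ≤ y'
        subst₂' refl refl h = h
EvalB-resp (a b< b) eq h = subst₂' (⟦⟧ₜ-resp a eq) (⟦⟧ₜ-resp b eq) h
  where subst₂' : ∀ {x x' y y'} → x ≡ x' → y ≡ y' → x < y → x' < y'
        subst₂' refl refl h = h
EvalB-resp (a b= b) eq h = trans (sym (⟦⟧ₜ-resp a eq)) (trans h (⟦⟧ₜ-resp b eq))
EvalB-resp (p b∧ q) eq (h , k) = EvalB-resp p eq h , EvalB-resp q eq k
EvalB-resp (p b∨ q) eq (inj₁ h) = inj₁ (EvalB-resp p eq h)
EvalB-resp (p b∨ q) eq (inj₂ h) = inj₂ (EvalB-resp q eq h)
EvalB-resp (b¬ p) eq h k = h (EvalB-resp p (λ x → sym (eq x)) k)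

-- Operations.  Primitive calls f(c₁,…,cₙ) have statically known integer
-- constant arguments (standing assumption of the paper).

data Op (Prim : Set) (arity : Prim → ℕ) (V : Set) : Set where
  assign : V → Expr V → Op Prim arity V
  call   : V → (f : Prim) → Vec ℤ (arity f) → Op Prim arity V
  assume : BExpr V → Op Prim arity V

-- operations without primitive calls (the  \hat{op}  of rule (E1))
data HOp (V : Set) : Set where
  hassign : V → Expr V → HOp V
  hassume : BExpr V → HOp V

-- Formulas, semantically: predicates on states that respect
-- pointwise equality of states (as every first-order formula does).

record Pred (V : Set) : Set₁ where
  field
    holds : (V → ℤ) → Set
    resp  : ∀ {s s' : V → ℤ} → s ≗ s' → holds s → holds s'
open Pred public

_∧ₚ_ : {V : Set} → Pred V → Pred V → Pred V
holds (φ ∧ₚ ψ) s = holds φ s × holds ψ s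
resp (φ ∧ₚ ψ) eq (h , k) = resp φ eq h , resp ψ eq k

pullP : {W V : Set} → (W → V) → Pred W → Pred V
holds (pullP emb φ) s = holds φ (λ w → s (emb w))
resp (pullP emb φ) eq h = resp φ (λ w → eq (emb w)) h

Upd : {V : Set} → (V → ℤ) → V → ℤ → (V → ℤ) → Set
Upd {V} s y v s' = s' y ≡ v × ((z : V) → z ≢ y → s' z ≡ s z)

SP : {W V : Set} → (W → V) → HOp W → Pred V → Pred V
holds (SP {V = V} emb (hassign x e) ψ) s =
  Σ (V → ℤ) λ s₀ → holds ψ s₀ × Σ ℤ λ v → EvalE (λ w → s₀ (emb w)) e v × Upd s₀ (emb x) v s
resp (SP emb (hassign x e) ψ) eq (s₀ , p , v , ev , (u₁ , u₂)) =
  s₀ , p , v , ev , (trans (sym (eq (emb x))) u₁ , λ z nz → trans (sym (eq z)) (u₂ z nz))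
holds (SP emb (hassume b) ψ) s = holds ψ s × EvalB b (λ w → s (emb w))
resp (SP emb (hassume b) ψ) eq (h , k) = resp ψ eq h , EvalB-resp b (λ w → eq (emb w)) k

data BComb (n : ℕ) : Set where
  catom : Fin n → BComb n
  ctrue cfalse : BComb n
  _c∧_ _c∨_ : BComb n → BComb n → BComb n
  c¬_ : BComb n → BComb n

⟦_⟧ᶜ : {W : Set} (π : List (Pred W)) → BComb (length π) → (W → ℤ) → Set
⟦ π ⟧ᶜ (catom k) w = holds (lookup π k) w
⟦ π ⟧ᶜ ctrue w = ⊤
⟦ π ⟧ᶜ cfalse w = ⊥
⟦ π ⟧ᶜ (a c∧ b) w = ⟦ π ⟧ᶜ a w × ⟦ π ⟧ᶜ b w
⟦ π ⟧ᶜ (a c∨ b) w = ⟦ π ⟧ᶜ a w ⊎ ⟦ π ⟧ᶜ b w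
⟦ π ⟧ᶜ (c¬ a) w = ¬ ⟦ π ⟧ᶜ a w

⟦⟧ᶜ-resp : {W : Set} (π : List (Pred W)) (B : BComb (length π)) {s s' : W → ℤ} →
           s ≗ s' → ⟦ π ⟧ᶜ B s → ⟦ π ⟧ᶜ B s'
⟦⟧ᶜ-resp π (catom k) eq h = resp (lookup π k) eq h
⟦⟧ᶜ-resp π ctrue eq h = h
⟦⟧ᶜ-resp π cfalse eq h = h
⟦⟧ᶜ-resp π (a c∧ b) eq (h , k) = ⟦⟧ᶜ-resp π a eq h , ⟦⟧ᶜ-resp π b eq k
⟦⟧ᶜ-resp π (a c∨ b) eq (inj₁ h) = inj₁ (⟦⟧ᶜ-resp π a eq h)
⟦⟧ᶜ-resp π (a c∨ b) eq (inj₂ h) = inj₂ (⟦⟧ᶜ-resp π b eq h)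
⟦⟧ᶜ-resp π (c¬ a) eq h k = h (⟦⟧ᶜ-resp π a (λ x → sym (eq x)) k)

-- Predicate abstraction: the strongest Boolean combination of predicates of π
-- implied by ψ, i.e. the conjunction of all Boolean combinations B over π
-- with ψ ⇒ B.
α : {V W : Set} → ((V → ℤ) → (W → ℤ)) → List (Pred W) → Pred V → Pred W
holds (α {V} proj π ψ) w =
  (B : BComb (length π)) → ((t : V → ℤ) → holds ψ t → ⟦ π ⟧ᶜ B (proj t)) → ⟦ π ⟧ᶜ B w
resp (α proj π ψ) eq h B imp = ⟦⟧ᶜ-resp π B eq (h B imp)

record Program : Set₁ where
  field
    N     : ℕ                              -- threads T₁ … T_N are  Fin N
    main  : Fin N
    GV    : Set
    LV    : Fin N → Set
    SchedState : Set
    status     : SchedState → Fin N → Status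
    atMostOneRunning : ∀ S i j → status S i ≡ Running → status S j ≡ Running → i ≡ j
    -- the scheduler Sched, as the relation  S' ∈ Sched(S)
    Sched      : SchedState → SchedState → Set
    Sched-dom  : ∀ {S S'} → Sched S S' → ∀ i → status S i ≢ Running
    Sched-cod  : ∀ {S S'} → Sched S S' → ∃ λ i → status S' i ≡ Running
    Prim   : Set
    arity  : Prim → ℕ
    prim'  : (f : Prim) → Vec ℤ (arity f) → SchedState → ℤ × SchedState
    L      : Fin N → Set
    Edge   : (i : Fin N) → L i → Op Prim arity (LV i ⊎ GV) → L i → Set
    entry  : (i : Fin N) → L i
    Err    : (i : Fin N) → L i → Set
    entry-no-in : ∀ i l op → ¬ Edge i l op (entry i)
    err-no-out  : ∀ i l → Err i l → ∀ op l' → ¬ Edge i l op l'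

module _ (P : Program) where
  open Program P

  ThrVar : Fin N → Set
  ThrVar i = LV i ⊎ GV

  AllVar : Set
  AllVar = (Σ (Fin N) LV) ⊎ GV

  OpT : Fin N → Set
  OpT i = Op Prim arity (ThrVar i)

  emb : (i : Fin N) → ThrVar i → AllVar
  emb i (inj₁ x) = inj₁ (i , x)
  emb i (inj₂ g) = inj₂ g

  restrict : (i : Fin N) → (AllVar → ℤ) → (ThrVar i → ℤ)
  restrict i s = λ y → s (emb i y)

  NoRunning : SchedState → Set
  NoRunning S = ∀ i → status S i ≢ Running

  record Config : Set where
    field
      cloc   : (i : Fin N) → L i
      clocal : (i : Fin N) → LV i → ℤ
      cglob  : GV → ℤ
      csched : SchedState
  open Config public

  fullState : Config → AllVar → ℤ
  fullState γ (inj₁ (i , x)) = clocal γ i x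
  fullState γ (inj₂ g) = cglob γ g

  threadState : Config → (i : Fin N) → ThrVar i → ℤ
  threadState γ i = restrict i (fullState γ)

  OpEffect : Config → (i : Fin N) → OpT i → Config → Set
  OpEffect γ i (assign x e) γ' =
    Σ ℤ λ v → EvalE (threadState γ i) e v
            × Upd (fullState γ) (emb i x) v (fullState γ')
            × csched γ' ≡ csched γ
  OpEffect γ i (call x f args) γ' =
    Upd (fullState γ) (emb i x) (proj₁ (prim' f args (csched γ))) (fullState γ')
    × csched γ' ≡ proj₂ (prim' f args (csched γ))
  OpEffect γ i (assume b) γ' =
    EvalB b (threadState γ i) × fullState γ' ≗ fullState γ × csched γ' ≡ csched γ

  StepVia : Config → (i : Fin N) → L i → OpT i → L i → Config → Set
  StepVia γ i l op l' γ' =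
    status (csched γ) i ≡ Running × Edge i l op l'
    × cloc γ i ≡ l × cloc γ' i ≡ l' × (∀ j → j ≢ i → cloc γ' j ≡ cloc γ j)
    × OpEffect γ i op γ'

  Step : Config → (i : Fin N) → OpT i → Config → Set
  Step γ i op γ' = Σ (L i) λ l' → StepVia γ i (cloc γ i) op l' γ'

  SchedStep : Config → Config → Set
  SchedStep γ γ' =
    NoRunning (csched γ) × Sched (csched γ) (csched γ')
    × (∀ i → cloc γ' i ≡ cloc γ i) × fullState γ' ≗ fullState γ

  record Node : Set₁ where
    field
      nloc   : (i : Fin N) → L i
      nreg   : (i : Fin N) → Pred (ThrVar i)
      nglob  : Pred AllVar
      nsched : SchedState
  open Node public

  record Precision : Set₁ where
    field
      πloc  : (i : Fin N) → L i → List (Pred (ThrVar i))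
      πglob : List (Pred AllVar)
  open Precision public

  _⊨_ : Config → Node → Set
  γ ⊨ η = (∀ i → cloc γ i ≡ nloc η i)
        × (∀ i → holds (nreg η i) (threadState γ i))
        × holds (nglob η) (fullState γ)
        × csched γ ≡ nsched η

  hat : {V : Set} → Op Prim arity V → SchedState → HOp V × SchedState
  hat (assign x e) S = hassign x e , S
  hat (call x f args) S = hassign x (econst (proj₁ (prim' f args S))) , proj₂ (prim' f args S)
  hat (assume b) S = hassume b , S

  preRegion : Node → (j : Fin N) → Pred AllVar
  preRegion η j = pullP (emb j) (nreg η j) ∧ₚ nglob η

  -- new region of a thread j ≠ i (havoc of the globals possibly updated)
  otherRegion : Precision → Node → (i j : Fin N) → HOp (ThrVar i) → Pred (ThrVar j)
  otherRegion π η i j (hassign (inj₂ g) e) =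
    α (restrict j) (πloc π j (nloc η j)) (SP (emb i) (hassign (inj₂ g) estar) (preRegion η j))
  otherRegion π η i j (hassign (inj₁ x) e) = nreg η j
  otherRegion π η i j (hassume b) = nreg η j

  e1Loc : Node → (i : Fin N) → L i → (j : Fin N) → L j
  e1Loc η i l' j with i ≟ j
  ... | yes refl = l'
  ... | no _ = nloc η j

  e1Reg : Precision → Node → (i : Fin N) → OpT i → L i → (j : Fin N) → Pred (ThrVar j)
  e1Reg π η i op l' j with i ≟ j
  ... | yes refl = α (restrict i) (πloc π i l') (SP (emb i) (proj₁ (hat op (nsched η))) (preRegion η i))
  ... | no _ = otherRegion π η i j (proj₁ (hat op (nsched η)))

  e1Node : Precision → Node → (i : Fin N) → OpT i → L i → Node
  e1Node π η i op l' = record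
    { nloc   = e1Loc η i l'
    ; nreg   = e1Reg π η i op l'
    ; nglob  = α (λ s → s) (πglob π) (SP (emb i) (proj₁ (hat op (nsched η))) (nglob η))
    ; nsched = proj₂ (hat op (nsched η))
    }

  E1Succ : Precision → Node → Node → (i : Fin N) → OpT i → L i → Set₁
  E1Succ π η η' i op l' =
    status (nsched η) i ≡ Running × Edge i (nloc η i) op l' × η' ≡ e1Node π η i op l'

  E2Succ : Node → Node → Set₁
  E2Succ η η' =
    NoRunning (nsched η) × Sched (nsched η) (nsched η')
    × (∀ i → nloc η' i ≡ nloc η i) × nreg η' ≡ nreg η × nglob η' ≡ nglob η

module Submission where

-- Every region of an (E1)-successor is a predicate abstraction α of a strongest
-- post-condition, and α over-approximates its argument (α-sound).  Hence it
-- suffices to show that the concrete successor state satisfies the strongest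
-- post-condition being abstracted:
--   * for the executing thread and for the global region, the concrete effect of
--     op from a state satisfying ψ lands in SP of the primitive-free operation
--     op-hat (hat-post-sound), and it yields exactly the scheduler state that
--     rule (E1) records (hat-sched);
--   * for another thread j, a write to a local variable of the executing thread
--     leaves the view of j unchanged (Upd-frame), while a write to a global
--     variable is covered by the havoc post-condition (SP-assign-sound with *);
--     this is otherRegion-sound.
-- Rule (E2) changes neither locations nor valuations, so that case is a direct
-- transport of γ ⊨ η (e2-sound).

open import Defs
open import Data.Integer using (ℤ)
open import Data.List using (List)
open import Data.Fin using (Fin; _≟_)
open import Data.Product using (_×_; _,_; proj₁; proj₂)
open import Data.Sum using (inj₁; inj₂)
open import Relation.Nullary using (yes; no)
open import Relation.Binary.PropositionalEquality
  using (_≡_; _≢_; _≗_; refl; sym; trans; subst)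

α-sound : {V W : Set} (proj : (V → ℤ) → (W → ℤ)) (π : List (Pred W)) (ψ : Pred V)
          (t : V → ℤ) → holds ψ t → holds (α proj π ψ) (proj t)
α-sound proj π ψ t h B imp = imp t h

SP-assign-sound : {W V : Set} (emb : W → V) (x : W) (e : Expr W) (ψ : Pred V)
                  {s s' : V → ℤ} {v : ℤ} → holds ψ s →
                  EvalE (λ w → s (emb w)) e v → Upd s (emb x) v s' →
                  holds (SP emb (hassign x e) ψ) s'
SP-assign-sound emb x e ψ {s} {v = v} h ev upd = s , h , v , ev , upd

SP-assume-sound : {W V : Set} (emb : W → V) (b : BExpr W) (ψ : Pred V)
                  {s s' : V → ℤ} → holds ψ s → EvalB b (λ w → s (emb w)) →
                  s' ≗ s → holds (SP emb (hassume b) ψ) s'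
SP-assume-sound emb b ψ h eb same =
  resp ψ (λ z → sym (same z)) h , EvalB-resp b (λ w → sym (same (emb w))) eb

Upd-frame : {W V : Set} (view : W → V) {s s' : V → ℤ} {y : V} {v : ℤ} →
            Upd s y v s' → (∀ w → view w ≢ y) →
            (λ w → s (view w)) ≗ (λ w → s' (view w))
Upd-frame view (_ , unchanged) avoids w = sym (unchanged (view w) (avoids w))

module _ (P : Program) where
  open Program P

  local-invisible : (i j : Fin N) → j ≢ i → (x : LV i) →
                    (y : ThrVar P j) → emb P j y ≢ emb P i (inj₁ x)
  local-invisible i j j≢i x (inj₁ z) refl = j≢i refl
  local-invisible i j j≢i x (inj₂ g) ()

  hat-post-sound : (i : Fin N) (op : OpT P i) {γ γ' : Config P} {S : SchedState} →
    csched γ ≡ S → OpEffect P γ i op γ' → (ψ : Pred (AllVar P)) →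
    holds ψ (fullState P γ) →
    holds (SP (emb P i) (proj₁ (hat P op S)) ψ) (fullState P γ')
  hat-post-sound i (assign x e) _ (v , ev , upd , _) ψ h =
    SP-assign-sound (emb P i) x e ψ h ev upd
  hat-post-sound i (call x f args) refl (upd , _) ψ h =
    SP-assign-sound (emb P i) x _ ψ h (ev-const _) upd
  hat-post-sound i (assume b) _ (eb , same , _) ψ h =
    SP-assume-sound (emb P i) b ψ h eb same

  hat-sched : (i : Fin N) (op : OpT P i) {γ γ' : Config P} {S : SchedState} →
    csched γ ≡ S → OpEffect P γ i op γ' → csched γ' ≡ proj₂ (hat P op S)
  hat-sched i (assign x e) γ≡S (_ , _ , _ , same) = trans same γ≡S
  hat-sched i (call x f args) refl (_ , new) = new
  hat-sched i (assume b) γ≡S (_ , _ , same) = trans same γ≡S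

  module _ (π : Precision P) (η : Node P) (i j : Fin N) (j≢i : j ≢ i)
           {γ γ' : Config P}
           (reg-j : holds (nreg η j) (threadState P γ j))
           (glob : holds (nglob η) (fullState P γ)) where

    -- A write x := e of thread i, with any value v, preserves the region of j:
    -- locals of i are framed out, globals are covered by the havoc abstraction.
    write-preserves-other : (x : ThrVar P i) (e : Expr (ThrVar P i)) {v : ℤ} →
      Upd (fullState P γ) (emb P i x) v (fullState P γ') →
      holds (otherRegion P π η i j (hassign x e)) (threadState P γ' j)
    write-preserves-other (inj₁ x) e upd =
      resp (nreg η j) (Upd-frame (emb P j) upd (local-invisible i j j≢i x)) reg-j
    write-preserves-other (inj₂ g) e (_ , unchanged) =
      α-sound (restrict P j) (πloc π j (nloc η j))
        (SP (emb P i) (hassign (inj₂ g) estar) (preRegion P η j)) (fullState P γ')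
        (SP-assign-sound (emb P i) (inj₂ g) estar (preRegion P η j)
           (reg-j , glob) (ev-star _) (refl , unchanged))

    otherRegion-sound : (op : OpT P i) → OpEffect P γ i op γ' →
      holds (otherRegion P π η i j (proj₁ (hat P op (nsched η)))) (threadState P γ' j)
    otherRegion-sound (assign x e) (_ , _ , upd , _) = write-preserves-other x e upd
    otherRegion-sound (call x f args) (upd , _) = write-preserves-other x _ upd
    otherRegion-sound (assume b) (_ , same , _) =
      resp (nreg η j) (λ y → sym (same (emb P j y))) reg-j

  e1-sound : (π : Precision P) (η : Node P) (γ : Config P) → _⊨_ P γ η →
    (i : Fin N) (op : OpT P i) (l' : L i) (γ' : Config P) →
    StepVia P γ i (nloc η i) op l' γ' → _⊨_ P γ' (e1Node P π η i op l')
  e1-sound π η γ (locs , regs , glob , sched) i op l' γ'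
           (_ , _ , _ , at-l' , others-stay , eff) =
    locs' , regs' , glob' , hat-sched i op sched eff
    where
    SP-pre : Pred (AllVar P) → Pred (AllVar P)
    SP-pre = SP (emb P i) (proj₁ (hat P op (nsched η)))

    post : (ψ : Pred (AllVar P)) → holds ψ (fullState P γ) → holds (SP-pre ψ) (fullState P γ')
    post = hat-post-sound i op sched eff

    locs' : ∀ j → cloc γ' j ≡ e1Loc P η i l' j
    locs' j with i ≟ j
    ... | yes refl = at-l'
    ... | no i≢j = trans (others-stay j (λ j≡i → i≢j (sym j≡i))) (locs j)

    regs' : ∀ j → holds (e1Reg P π η i op l' j) (threadState P γ' j)
    regs' j with i ≟ j
    ... | yes refl = α-sound (restrict P i) (πloc π i l') (SP-pre (preRegion P η i))
                       (fullState P γ') (post (preRegion P η i) (regs i , glob))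
    ... | no i≢j = otherRegion-sound π η i j (λ j≡i → i≢j (sym j≡i)) (regs j) glob op eff

    glob' : holds (nglob (e1Node P π η i op l')) (fullState P γ')
    glob' = α-sound (λ s → s) (πglob π) (SP-pre (nglob η)) (fullState P γ') (post (nglob η) glob)

  e2-sound : (η η' : Node P) (γ : Config P) → _⊨_ P γ η → E2Succ P η η' →
    (γ' : Config P) → SchedStep P γ γ' → csched γ' ≡ nsched η' → _⊨_ P γ' η'
  e2-sound η η' γ (locs , regs , glob , _) (_ , _ , same-nloc , same-nreg , same-nglob)
           γ' (_ , _ , same-cloc , same-state) sched' =
    locs' , regs' , glob' , sched'
    where
    locs' : ∀ i → cloc γ' i ≡ nloc η' i
    locs' i = trans (same-cloc i) (trans (locs i) (sym (same-nloc i)))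

    regs' : ∀ i → holds (nreg η' i) (threadState P γ' i)
    regs' i = subst (λ R → holds (R i) (threadState P γ' i)) (sym same-nreg)
                (resp (nreg η i) (λ y → sym (same-state (emb P i y))) (regs i))

    glob' : holds (nglob η') (fullState P γ')
    glob' = subst (λ R → holds R (fullState P γ')) (sym same-nglob)
              (resp (nglob η) (λ z → sym (same-state z)) glob)

lemma4p6 : (P : Program) (π : Precision P) (η η' : Node P) (γ : Config P) →
    _⊨_ P γ η →
    ((i : Fin (Program.N P)) (op : OpT P i) (l' : Program.L P i) →
       E1Succ P π η η' i op l' →
       (γ' : Config P) → StepVia P γ i (nloc η i) op l' γ' → _⊨_ P γ' η')
    ×
    (E2Succ P η η' →
       (γ' : Config P) → SchedStep P γ γ' → csched γ' ≡ nsched η' → _⊨_ P γ' η')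
lemma4p6 P π η η' γ γ⊨η = part1 , e2-sound P η η' γ γ⊨η
  where
  part1 : (i : Fin (Program.N P)) (op : OpT P i) (l' : Program.L P i) →
          E1Succ P π η η' i op l' →
          (γ' : Config P) → StepVia P γ i (nloc η i) op l' γ' → _⊨_ P γ' η'
  part1 i op l' (_ , _ , refl) = e1-sound P π η γ γ⊨η i op l'
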